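{- Let $p\geq 5$ be an odd prime with $p \equiv 3 \pmod{4}$ and write $p-1=2r$ with $r>1$ odd. Set $m := \operatorname{ord}_r(2)$. Then $14$ nontrivially flanks $2p$ at distance $1$ at some $k$ (i.e., there exists $k\ge 1$ with $2p\in S_k$, $14\in S_{k-1}$ and $14\in S_{k+1}$) if and only if there exists an even integer $t_0 \ge 2$ such that $2^{t_0} \equiv -1 \pmod{r}$. In this case, for the minimal such $t_0$, we have $m = 2t_0$, the least $k \ge 0$ with $r \mid (2^{k+1}+1)$ is $k_{\min} := t_0 - 1$, and the set of all $k\ge 0$ with $r\mid(2^{k+1}+1)$ is exactly the set of $k\ge 0$ with $k \equiv t_0 - 1 \pmod{2t_0}$. Moreover, if $r$ is prime, then the condition on $r$ (existence of an even $t_0\ge 2$ with $2^{t_0}\equiv -1\pmod r$) is equivalent to $4 \mid \operatorname{ord}_r(2)$.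
   Context: For integers $k\ge 0$ and $n\ge 1$, $\sigma_k(n)=\sum_{d\mid n} d^k$ and $\phi(n)$ is Euler's totient function. For each $k\geq 0$, $S_k$ denotes the set of composite positive integers $n$ satisfying $n\cdot\sigma_k(n)\equiv 2 \pmod{\phi(n)}$. $\operatorname{ord}_r(2)$ is the multiplicative order of $2$ modulo $r$. -}

module Defs where

open import Data.Nat using (ℕ; zero; suc; _+_; _*_; _∸_; _^_; _≤_; _<_; ∣_-_∣)
open import Data.Nat.Divisibility using (_∣_; _∣?_)
open import Data.Nat.GCD using (gcd)
open import Data.Nat.Primality using (Composite)
open import Data.Nat.Properties using (_≟_)
open import Data.Nat.ListAction using (sum)
open import Data.List using (List; map; filter; length; applyUpTo)
open import Data.Product using (_×_; ∃-syntax)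
open import Function.Bundles using (_⇔_)

infix 4 _≡_[mod_]
_≡_[mod_] : ℕ → ℕ → ℕ → Set
a ≡ b [mod n ] = n ∣ ∣ a - b ∣

oneTo : ℕ → List ℕ
oneTo n = applyUpTo suc n

divisors : ℕ → List ℕ
divisors n = filter (_∣? n) (oneTo n)

σ : ℕ → ℕ → ℕ
σ k n = sum (map (λ d → d ^ k) (divisors n))

φ : ℕ → ℕ
φ n = length (filter (λ i → gcd i n ≟ 1) (oneTo n))

S : ℕ → ℕ → Set
S k n = Composite n × (n * σ k n ≡ 2 [mod φ n ])

FlanksAtSomeK : ℕ → Set
FlanksAtSomeK p = ∃[ k ] (1 ≤ k × S k (2 * p) × S (k ∸ 1) 14 × S (suc k) 14)

IsOrd2 : ℕ → ℕ → Set
IsOrd2 r m = 1 ≤ m × (2 ^ m ≡ 1 [mod r ]) × (∀ j → 1 ≤ j → 2 ^ j ≡ 1 [mod r ] → m ≤ j)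

GoodT : ℕ → ℕ → Set
GoodT r t = 2 ∣ t × 2 ≤ t × r ∣ (2 ^ t + 1)

MinGoodT : ℕ → ℕ → Set
MinGoodT r t0 = GoodT r t0 × (∀ t → GoodT r t → t0 ≤ t)

LeastK : ℕ → ℕ → Set
LeastK r k = r ∣ (2 ^ suc k + 1) × (∀ j → r ∣ (2 ^ suc j + 1) → k ≤ j)

-- Write p = 2r + 1. The divisors of 2p are 1, 2, p, 2p and φ(2p) = 2r, so since p ≡ 1 (mod r)
-- the condition 2p ∈ S_k becomes 2^(k+1) ≡ −1 (mod r). Modulo 6, 14·σ_k(14) has period 2 in k,
-- so 14 ∈ S_k iff k is even; hence 14 flanks 2p at k iff t = k + 1 is even with 2^t ≡ −1 (mod r).
-- If 2^t ≡ −1 then m = ord_r(2) divides 2t but not t (as r ∤ 2), which forces m = 2(t mod m):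
-- the exponents t with 2^t ≡ −1 are exactly the odd multiples of m/2, so an even one exists iff
-- m/2 is even, and then the least is m/2. For prime r the only square roots of 1 are ±1, so
-- 4 ∣ m makes 2^(m/2) ≡ −1.

module Submission where

open import Defs
open import Data.Nat using (ℕ; suc; _+_; _*_; _∸_; _^_; _≤_; _%_)
open import Data.Nat.Divisibility using (_∣_)
open import Data.Nat.Primality using (Prime)
open import Data.Product using (_×_; ∃-syntax)
open import Function.Bundles using (_⇔_)
open import Relation.Binary.PropositionalEquality using (_≡_)

open import Data.Empty using (⊥-elim)
open import Data.List using ([]; _∷_; _++_; _∷ʳ_; filter; length; map)
open import Data.List.Properties using (applyUpTo-∷ʳ; filter-++; filter-accept; filter-reject; length-++; ++-identityʳ)
open import Data.Nat
open import Data.Nat.Coprimality using (Coprime; coprime⇒gcd≡1; gcd≡1⇒coprime; coprime-divisor)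
open import Data.Nat.DivMod
open import Data.Nat.Divisibility
open import Data.Nat.GCD using (gcd)
open import Data.Nat.ListAction using (sum)
open import Data.Nat.Primality using (euclidsLemma; prime⇒irreducible; prime⇒nonZero; prime?; composite-≢)
open import Data.Nat.Properties
open import Data.Nat.Solver using (module +-*-Solver)
open import Data.Product using (_,_; proj₁; proj₂; map₂)
open import Data.Sum using (_⊎_; inj₁; inj₂; [_,_]′)
open import Function.Base using (id; _∘_; case_of_)
open import Function.Bundles using (mk⇔; Equivalence)
open import Function.Construct.Symmetry using (⇔-sym)
open import Function.Related.Propositional using (module EquationalReasoning)
open import Relation.Binary.Bundles using (Setoid)
open import Relation.Binary.PropositionalEquality
open import Relation.Binary.Structures using (IsEquivalence)
import Relation.Binary.Reasoning.Setoid as SetoidReasoning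
open import Relation.Nullary using (¬_; yes; no)
open import Relation.Nullary.Decidable using (from-yes)
open import Relation.Unary using (Decidable)

open +-*-Solver using (solve; _:+_; _:*_; _:=_; con)

2∤1+2*x : ∀ {x} → ¬ 2 ∣ 1 + 2 * x
2∤1+2*x {x} 2∣1+2x with () ← ∣1⇒≡1 (∣m+n∣m⇒∣n (subst (2 ∣_) (+-comm 1 (2 * x)) 2∣1+2x) (divides x (*-comm 2 x)))

∣∧≤2*⇒≡⊎≡2* : ∀ {m n} → m ∣ n → 0 < n → n ≤ 2 * m → n ≡ m ⊎ n ≡ 2 * m
∣∧≤2*⇒≡⊎≡2*         (divides 1 refl)                   _   _    = inj₁ (*-identityˡ _)
∣∧≤2*⇒≡⊎≡2*         (divides 2 refl)                   _   _    = inj₂ refl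
∣∧≤2*⇒≡⊎≡2* {zero}  (divides q refl)                   0<n _    = ⊥-elim (<⇒≢ 0<n (sym (*-zeroʳ q)))
∣∧≤2*⇒≡⊎≡2* {suc _} (divides 0 refl)                   ()  _
∣∧≤2*⇒≡⊎≡2* {m@(suc _)} (divides q@(suc (suc (suc _))) refl) _ n≤2m =
  ⊥-elim (<⇒≱ (*-monoˡ-< m {2} {q} (s≤s (s≤s (s≤s z≤n)))) n≤2m)

∣2⇒≡1⊎≡2 : ∀ {d} → d ∣ 2 → d ≡ 1 ⊎ d ≡ 2
∣2⇒≡1⊎≡2 = prime⇒irreducible (from-yes (prime? 2))

∣2*p⇒≡1⊎≡2⊎≡p⊎≡2*p : ∀ {p d} → Prime p → d ∣ 2 * p → d ≡ 1 ⊎ d ≡ 2 ⊎ d ≡ p ⊎ d ≡ 2 * p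
∣2*p⇒≡1⊎≡2⊎≡p⊎≡2*p {p} {d} p-prime d∣2p with p ∣? d
... | yes (divides e refl) = [ (λ { refl → inj₂ (inj₂ (inj₁ (*-identityˡ p))) })
                            , (λ { refl → inj₂ (inj₂ (inj₂ refl)) }) ]′ (∣2⇒≡1⊎≡2 (*-cancelʳ-∣ {e} {2} p d∣2p))
  where instance _ = prime⇒nonZero p-prime
... | no  p∤d              = [ inj₁ , inj₂ ∘ inj₁ ]′ (∣2⇒≡1⊎≡2 (coprime-divisor d⊥p (subst (d ∣_) (*-comm 2 p) d∣2p)))
  where
  d⊥p : Coprime d p
  d⊥p (c∣d , c∣p) = [ id , (λ { refl → ⊥-elim (p∤d c∣d) }) ]′ (prime⇒irreducible p-prime c∣p)

*-cancelˡ-≡[mod] : ∀ c {a b n} .{{_ : NonZero c}} → (c * a ≡ c * b [mod c * n ]) ⇔ (a ≡ b [mod n ])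
*-cancelˡ-≡[mod] c {a} {b} {n} = mk⇔
  (*-cancelˡ-∣ c ∘ subst (c * n ∣_) (sym (*-distribˡ-∣-∣ c a b)))
  (subst (c * n ∣_) (*-distribˡ-∣-∣ c a b) ∘ *-monoʳ-∣ c)

common-divisor⇒gcd≢1 : ∀ {d i n} → 1 < d → d ∣ i → d ∣ n → gcd i n ≢ 1
common-divisor⇒gcd≢1 1<d d∣i d∣n gcd≡1 = <⇒≢ 1<d (sym (gcd≡1⇒coprime gcd≡1 (d∣i , d∣n)))

module Modular (n : ℕ) .{{_ : NonZero n}} where

  -- A record rather than a bare equation, so that a and b can be inferred from a proof of a ≈ b.
  infix 4 _≈_
  record _≈_ (a b : ℕ) : Set where
    constructor mk≈
    field %-≡ : a % n ≡ b % n

  ≈-isEquivalence : IsEquivalence _≈_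
  ≈-isEquivalence = record
    { refl  = mk≈ refl
    ; sym   = λ (mk≈ e) → mk≈ (sym e)
    ; trans = λ (mk≈ e) (mk≈ f) → mk≈ (trans e f)
    }

  ≈-setoid : Setoid _ _
  ≈-setoid = record { isEquivalence = ≈-isEquivalence }

  open IsEquivalence ≈-isEquivalence public
    using (reflexive) renaming (refl to ≈-refl; sym to ≈-sym; trans to ≈-trans)

  +-cong : ∀ {a b c d} → a ≈ b → c ≈ d → a + c ≈ b + d
  +-cong {a} {b} {c} {d} (mk≈ e) (mk≈ f) = mk≈ (begin
    (a + c) % n             ≡⟨ %-distribˡ-+ a c n ⟩
    (a % n + c % n) % n     ≡⟨ cong₂ (λ x y → (x + y) % n) e f ⟩
    (b % n + d % n) % n     ≡⟨ %-distribˡ-+ b d n ⟨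
    (b + d) % n             ∎)
    where open ≡-Reasoning

  *-cong : ∀ {a b c d} → a ≈ b → c ≈ d → a * c ≈ b * d
  *-cong {a} {b} {c} {d} (mk≈ e) (mk≈ f) = mk≈ (begin
    (a * c) % n             ≡⟨ %-distribˡ-* a c n ⟩
    (a % n * (c % n)) % n   ≡⟨ cong₂ (λ x y → (x * y) % n) e f ⟩
    (b % n * (d % n)) % n   ≡⟨ %-distribˡ-* b d n ⟨
    (b * d) % n             ∎)
    where open ≡-Reasoning

  ^-congˡ : ∀ {a b} k → a ≈ b → a ^ k ≈ b ^ k
  ^-congˡ zero    _   = ≈-refl
  ^-congˡ (suc k) a≈b = *-cong a≈b (^-congˡ k a≈b)

  m+k*n≈m : ∀ a k → a + k * n ≈ a
  m+k*n≈m a k = mk≈ ([m+kn]%n≡m%n a k n)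

  ∣⇔≈0 : ∀ {a} → n ∣ a ⇔ a ≈ 0
  ∣⇔≈0 {a} = mk⇔ (λ d → mk≈ (trans (n∣m⇒m%n≡0 a n d) (sym 0%n≡0)))
                  (λ (mk≈ e) → m%n≡0⇒n∣m a n (trans e 0%n≡0))
    where
    0%n≡0 : 0 % n ≡ 0
    0%n≡0 = m*n%n≡0 0 n

  private
    ∣⇔m+n≈m : ∀ a c → n ∣ c ⇔ a + c ≈ a
    ∣⇔m+n≈m a c = mk⇔ (mk≈ ∘ %-remove-+ʳ a) from
      where
      from : a + c ≈ a → n ∣ c
      from (mk≈ e) = ∣m+n∣m⇒∣n (divides ((a + c) / n) (+-cancelˡ-≡ (a % n) _ _ (begin
        a % n + (a / n * n + c)     ≡⟨ +-assoc (a % n) _ c ⟨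
        a % n + a / n * n + c       ≡⟨ cong (_+ c) (m≡m%n+[m/n]*n a n) ⟨
        a + c                       ≡⟨ m≡m%n+[m/n]*n (a + c) n ⟩
        (a + c) % n + (a + c) / n * n ≡⟨ cong (_+ (a + c) / n * n) e ⟩
        a % n + (a + c) / n * n     ∎))) (n∣m*n (a / n))
        where open ≡-Reasoning

    ≡[mod]⇔≈-≤ : ∀ {a b} → b ≤ a → a ≡ b [mod n ] ⇔ a ≈ b
    ≡[mod]⇔≈-≤ {a} {b} b≤a with c , refl ← m≤n⇒∃[o]m+o≡n b≤a =
      subst (λ x → n ∣ x ⇔ b + c ≈ b) (sym (trans (∣-∣-comm (b + c) b) (∣m-m+n∣≡n b c))) (∣⇔m+n≈m b c)

  ≡[mod]⇔≈ : ∀ {a b} → a ≡ b [mod n ] ⇔ a ≈ b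
  ≡[mod]⇔≈ {a} {b} with ≤-total b a
  ... | inj₁ b≤a = ≡[mod]⇔≈-≤ b≤a
  ... | inj₂ a≤b = mk⇔ (≈-sym ∘ to ∘ subst (n ∣_) (∣-∣-comm a b)) (subst (n ∣_) (∣-∣-comm b a) ∘ from ∘ ≈-sym)
    where open Equivalence (≡[mod]⇔≈-≤ a≤b)

  +-cancelʳ-≈ : ∀ {a b} c → a + c ≈ b + c → a ≈ b
  +-cancelʳ-≈ {a} {b} c a+c≈b+c = to ≡[mod]⇔≈ (subst (n ∣_) ∣a+c-b+c∣≡∣a-b∣ (from ≡[mod]⇔≈ a+c≈b+c))
    where
    open Equivalence
    ∣a+c-b+c∣≡∣a-b∣ : ∣ a + c - b + c ∣ ≡ ∣ a - b ∣
    ∣a+c-b+c∣≡∣a-b∣ = trans (cong₂ ∣_-_∣ (+-comm a c) (+-comm b c)) (∣m+n-m+o∣≡∣n-o∣ c a b)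

  module ≈-Reasoning = SetoidReasoning ≈-setoid

  x+1≈0⇒x*x≈1 : ∀ x → x + 1 ≈ 0 → x * x ≈ 1
  x+1≈0⇒x*x≈1 x x+1≈0 = +-cancelʳ-≈ x (begin
    x * x + x    ≡⟨ solve 1 (λ x → x :* x :+ x := x :* (x :+ con 1)) refl x ⟩
    x * (x + 1)  ≈⟨ *-cong (≈-refl {x}) x+1≈0 ⟩
    x * 0        ≡⟨ *-zeroʳ x ⟩
    0            ≈⟨ x+1≈0 ⟨
    x + 1        ≡⟨ +-comm x 1 ⟩
    1 + x        ∎)
    where open ≈-Reasoning

  x*x≈1⇒x≈1⊎x+1≈0 : Prime n → ∀ x → x * x ≈ 1 → x ≈ 1 ⊎ x + 1 ≈ 0
  x*x≈1⇒x≈1⊎x+1≈0 _     zero    0≈1 = inj₁ 0≈1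
  x*x≈1⇒x≈1⊎x+1≈0 n-prime (suc y) x*x≈1
    with euclidsLemma y (2 + y) n-prime (Equivalence.from ∣⇔≈0 y*[2+y]≈0)
    where
    y*[2+y]≈0 : y * (2 + y) ≈ 0
    y*[2+y]≈0 = +-cancelʳ-≈ 1 (begin
      y * (2 + y) + 1       ≡⟨ solve 1 (λ y → y :* (con 2 :+ y) :+ con 1 := (con 1 :+ y) :* (con 1 :+ y)) refl y ⟩
      suc y * suc y         ≈⟨ x*x≈1 ⟩
      1                     ∎)
      where open ≈-Reasoning
  ... | inj₁ n∣y   = inj₁ (+-cong (≈-refl {1}) (Equivalence.to ∣⇔≈0 n∣y))
  ... | inj₂ n∣2+y = inj₂ (subst (_≈ 0) (+-comm 1 (suc y)) (Equivalence.to ∣⇔≈0 n∣2+y))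

  ≈⇔∃[k]a≡b+k*n : ∀ {a b} → b < n → a ≈ b ⇔ (∃[ k ] a ≡ b + k * n)
  ≈⇔∃[k]a≡b+k*n {a} {b} b<n = mk⇔ to (λ where (k , refl) → m+k*n≈m b k)
    where
    to : a ≈ b → ∃[ k ] a ≡ b + k * n
    to (mk≈ e) = a / n , trans (m≡m%n+[m/n]*n a n) (cong (_+ a / n * n) (trans e (m<n⇒m%n≡m b<n)))

module _ {P : ℕ → Set} (P? : Decidable P) where

  filter-oneTo-accept : ∀ {m n} → suc m ≡ n → P n → filter P? (oneTo n) ≡ filter P? (oneTo m) ∷ʳ n
  filter-oneTo-accept {m} refl Pn = begin
    filter P? (oneTo (suc m))                         ≡⟨ cong (filter P?) (applyUpTo-∷ʳ suc m) ⟨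
    filter P? (oneTo m ∷ʳ suc m)                      ≡⟨ filter-++ P? (oneTo m) _ ⟩
    filter P? (oneTo m) ++ filter P? (suc m ∷ [])     ≡⟨ cong (filter P? (oneTo m) ++_) (filter-accept P? Pn) ⟩
    filter P? (oneTo m) ∷ʳ suc m                      ∎
    where open ≡-Reasoning

  filter-oneTo-reject : ∀ {m n} → suc m ≡ n → ¬ P n → filter P? (oneTo n) ≡ filter P? (oneTo m)
  filter-oneTo-reject {m} refl ¬Pn = begin
    filter P? (oneTo (suc m))                         ≡⟨ cong (filter P?) (applyUpTo-∷ʳ suc m) ⟨
    filter P? (oneTo m ∷ʳ suc m)                      ≡⟨ filter-++ P? (oneTo m) _ ⟩
    filter P? (oneTo m) ++ filter P? (suc m ∷ [])     ≡⟨ cong (filter P? (oneTo m) ++_) (filter-reject P? ¬Pn) ⟩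
    filter P? (oneTo m) ++ []                         ≡⟨ ++-identityʳ _ ⟩
    filter P? (oneTo m)                               ∎
    where open ≡-Reasoning

  filter-oneTo-gap : ∀ {a b} → a ≤ b → (∀ i → a < i → i ≤ b → ¬ P i) → filter P? (oneTo b) ≡ filter P? (oneTo a)
  filter-oneTo-gap = gap ∘ ≤⇒≤′
    where
    gap : ∀ {a b} → a ≤′ b → (∀ i → a < i → i ≤ b → ¬ P i) → filter P? (oneTo b) ≡ filter P? (oneTo a)
    gap (≤′-reflexive refl) _  = refl
    gap (≤′-step a≤′b)      ¬P = trans
      (filter-oneTo-reject refl (¬P _ (s≤s (≤′⇒≤ a≤′b)) ≤-refl))
      (gap a≤′b (λ i a<i i≤b → ¬P i a<i (m≤n⇒m≤1+n i≤b)))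

  countUpTo : ℕ → ℕ
  countUpTo n = length (filter P? (oneTo n))

  countUpTo-odd : ∀ a s → (∀ i → 2 * a < i → i ≤ 2 * (a + s) → P i ⇔ (¬ 2 ∣ i)) →
                  countUpTo (2 * (a + s)) ≡ countUpTo (2 * a) + s
  countUpTo-odd a zero    _      = trans (cong (λ x → countUpTo (2 * x)) (+-identityʳ a)) (sym (+-identityʳ _))
  countUpTo-odd a (suc s) P⇔odd = begin
    countUpTo (2 * (a + suc s))          ≡⟨ cong countUpTo 2[a+s+1]≡2+n ⟩
    countUpTo (2 + n)                    ≡⟨ cong length (filter-oneTo-reject refl ¬P[2+n]) ⟩
    countUpTo (1 + n)                    ≡⟨ cong length (filter-oneTo-accept refl P[1+n]) ⟩
    length (filter P? (oneTo n) ∷ʳ suc n) ≡⟨ length-++ (filter P? (oneTo n)) ⟩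
    countUpTo n + 1                      ≡⟨ cong (_+ 1) (countUpTo-odd a s P⇔odd′) ⟩
    countUpTo (2 * a) + s + 1            ≡⟨ solve 2 (λ x s → x :+ s :+ con 1 := x :+ (con 1 :+ s)) refl (countUpTo (2 * a)) s ⟩
    countUpTo (2 * a) + suc s            ∎
    where
    open ≡-Reasoning
    n = 2 * (a + s)
    2[a+s+1]≡2+n : 2 * (a + suc s) ≡ 2 + n
    2[a+s+1]≡2+n = solve 2 (λ a s → con 2 :* (a :+ (con 1 :+ s)) := con 2 :+ con 2 :* (a :+ s)) refl a s
    2*a≤n : 2 * a ≤ n
    2*a≤n = *-monoʳ-≤ 2 (m≤m+n a s)
    1+n≤ : 1 + n ≤ 2 * (a + suc s)
    1+n≤ = ≤-trans (n≤1+n (1 + n)) (≤-reflexive (sym 2[a+s+1]≡2+n))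
    P⇔odd′ : ∀ i → 2 * a < i → i ≤ n → P i ⇔ (¬ 2 ∣ i)
    P⇔odd′ i 2a<i i≤n = P⇔odd i 2a<i (≤-trans i≤n (≤-trans (n≤1+n n) 1+n≤))
    P[1+n] : P (1 + n)
    P[1+n] = Equivalence.from (P⇔odd (1 + n) (s≤s 2*a≤n) 1+n≤) (2∤1+2*x {a + s})
    ¬P[2+n] : ¬ P (2 + n)
    ¬P[2+n] P[2+n] = Equivalence.to (P⇔odd (2 + n) (m≤n⇒m≤1+n (s≤s 2*a≤n)) (≤-reflexive (sym 2[a+s+1]≡2+n))) P[2+n]
                       (∣m∣n⇒∣m+n ∣-refl (divides (a + s) (*-comm 2 (a + s))))

module PowersOfTwo (r : ℕ) .{{_ : NonZero r}} (r∤2 : ¬ r ∣ 2) {m : ℕ} (ord : IsOrd2 r m) where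

  open Modular r

  -- Stated as divisibility so that it agrees definitionally with GoodT and LeastK.
  infix 4 _≈-1
  _≈-1 : ℕ → Set
  x ≈-1 = r ∣ x + 1

  private
    m≥1 : 1 ≤ m
    m≥1 = proj₁ ord

    2^m≈1 : 2 ^ m ≈ 1
    2^m≈1 = Equivalence.to ≡[mod]⇔≈ (proj₁ (proj₂ ord))

    m-least : ∀ j → 1 ≤ j → 2 ^ j ≈ 1 → m ≤ j
    m-least j j≥1 = proj₂ (proj₂ ord) j j≥1 ∘ Equivalence.from ≡[mod]⇔≈

    instance
      m≢0 : NonZero m
      m≢0 = >-nonZero m≥1

  2^[k*m]≈1 : ∀ k → 2 ^ (k * m) ≈ 1
  2^[k*m]≈1 zero    = ≈-refl
  2^[k*m]≈1 (suc k) = begin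
    2 ^ (m + k * m)      ≡⟨ ^-distribˡ-+-* 2 m (k * m) ⟩
    2 ^ m * 2 ^ (k * m)  ≈⟨ *-cong 2^m≈1 (2^[k*m]≈1 k) ⟩
    1                    ∎
    where open ≈-Reasoning

  2^[a+k*m]≈2^a : ∀ a k → 2 ^ (a + k * m) ≈ 2 ^ a
  2^[a+k*m]≈2^a a k = begin
    2 ^ (a + k * m)      ≡⟨ ^-distribˡ-+-* 2 a (k * m) ⟩
    2 ^ a * 2 ^ (k * m)  ≈⟨ *-cong (≈-refl {2 ^ a}) (2^[k*m]≈1 k) ⟩
    2 ^ a * 1            ≡⟨ *-identityʳ (2 ^ a) ⟩
    2 ^ a                ∎
    where open ≈-Reasoning

  2^j≈1⇒m∣j : ∀ j → 2 ^ j ≈ 1 → m ∣ j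
  2^j≈1⇒m∣j j 2^j≈1 with j % m ≟ 0
  ... | yes j%m≡0 = m%n≡0⇒n∣m j m j%m≡0
  ... | no  j%m≢0 = ⊥-elim (<⇒≱ (m%n<n j m) (m-least (j % m) (n≢0⇒n>0 j%m≢0) 2^[j%m]≈1))
    where
    2^[j%m]≈1 : 2 ^ (j % m) ≈ 1
    2^[j%m]≈1 = begin
      2 ^ (j % m)                  ≈⟨ 2^[a+k*m]≈2^a (j % m) (j / m) ⟨
      2 ^ (j % m + j / m * m)      ≡⟨ cong (2 ^_) (m≡m%n+[m/n]*n j m) ⟨
      2 ^ j                        ≈⟨ 2^j≈1 ⟩
      1                            ∎
      where open ≈-Reasoning

  ≈-1-resp-≈ : ∀ {x y} → x ≈ y → x ≈-1 → y ≈-1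
  ≈-1-resp-≈ {x} {y} x≈y x≈-1 = Equivalence.from ∣⇔≈0 (begin
    y + 1  ≈⟨ +-cong x≈y (≈-refl {1}) ⟨
    x + 1  ≈⟨ Equivalence.to ∣⇔≈0 x≈-1 ⟩
    0      ∎)
    where open ≈-Reasoning

  ≈-1⇒≉1 : ∀ {x} → x ≈-1 → ¬ x ≈ 1
  ≈-1⇒≉1 x≈-1 x≈1 = r∤2 (≈-1-resp-≈ x≈1 x≈-1)

  2^[a+k*m]≈-1⇔2^a≈-1 : ∀ a k → 2 ^ (a + k * m) ≈-1 ⇔ 2 ^ a ≈-1
  2^[a+k*m]≈-1⇔2^a≈-1 a k =
    mk⇔ (≈-1-resp-≈ (2^[a+k*m]≈2^a a k)) (≈-1-resp-≈ (≈-sym (2^[a+k*m]≈2^a a k)))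

  2^t≈-1⇒2^[t%m]≈-1 : ∀ t → 2 ^ t ≈-1 → 2 ^ (t % m) ≈-1
  2^t≈-1⇒2^[t%m]≈-1 t 2^t≈-1 = Equivalence.to (2^[a+k*m]≈-1⇔2^a≈-1 (t % m) (t / m))
    (subst (λ s → 2 ^ s ≈-1) (m≡m%n+[m/n]*n t m) 2^t≈-1)

  2^t≈-1⇒m≡2*[t%m] : ∀ t → 2 ^ t ≈-1 → m ≡ 2 * (t % m)
  2^t≈-1⇒m≡2*[t%m] t 2^t≈-1 = [ sym , (λ 2ρ≡2m → ⊥-elim (<⇒≢ 2ρ<2m 2ρ≡2m)) ]′
    (∣∧≤2*⇒≡⊎≡2* m∣2ρ (*-monoʳ-< 2 ρ>0) (<⇒≤ 2ρ<2m))
    where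
    ρ = t % m
    2^ρ≈-1 : 2 ^ ρ ≈-1
    2^ρ≈-1 = 2^t≈-1⇒2^[t%m]≈-1 t 2^t≈-1
    ρ>0 : ρ > 0
    ρ>0 = n≢0⇒n>0 (λ ρ≡0 → ≈-1⇒≉1 2^ρ≈-1 (reflexive (cong (2 ^_) ρ≡0)))
    m∣2ρ : m ∣ 2 * ρ
    m∣2ρ = 2^j≈1⇒m∣j (2 * ρ) (begin
      2 ^ (ρ + (ρ + 0))     ≡⟨ cong (λ s → 2 ^ (ρ + s)) (+-identityʳ ρ) ⟩
      2 ^ (ρ + ρ)           ≡⟨ ^-distribˡ-+-* 2 ρ ρ ⟩
      2 ^ ρ * 2 ^ ρ         ≈⟨ x+1≈0⇒x*x≈1 (2 ^ ρ) (Equivalence.to ∣⇔≈0 2^ρ≈-1) ⟩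
      1                     ∎)
      where open ≈-Reasoning
    2ρ<2m : 2 * ρ < 2 * m
    2ρ<2m = *-monoʳ-< 2 (m%n<n t m)

  2^t≈-1⇔t≡h+k*m : ∀ {h} → m ≡ 2 * h → 2 ^ h ≈-1 → ∀ t → 2 ^ t ≈-1 ⇔ (∃[ k ] t ≡ h + k * m)
  2^t≈-1⇔t≡h+k*m {h} m≡2h 2^h≈-1 t = mk⇔ to from
    where
    to : 2 ^ t ≈-1 → ∃[ k ] t ≡ h + k * m
    to 2^t≈-1 = t / m , trans (m≡m%n+[m/n]*n t m) (cong (_+ t / m * m) t%m≡h)
      where
      t%m≡h : t % m ≡ h
      t%m≡h = *-cancelˡ-≡ (t % m) h 2 (trans (sym (2^t≈-1⇒m≡2*[t%m] t 2^t≈-1)) m≡2h)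
    from : ∃[ k ] t ≡ h + k * m → 2 ^ t ≈-1
    from (k , refl) = Equivalence.from (2^[a+k*m]≈-1⇔2^a≈-1 h k) 2^h≈-1

  good⇒good[t%m] : ∀ {t} → GoodT r t → GoodT r (t % m)
  good⇒good[t%m] {t} (2∣t , _ , 2^t≈-1) = 2∣ρ , ∣⇒≤ {{ρ≢0}} 2∣ρ , 2^t≈-1⇒2^[t%m]≈-1 t 2^t≈-1
    where
    ρ = t % m
    m≡2ρ : m ≡ 2 * ρ
    m≡2ρ = 2^t≈-1⇒m≡2*[t%m] t 2^t≈-1
    2∣ρ : 2 ∣ ρ
    2∣ρ = ∣m+n∣m⇒∣n (subst (2 ∣_) (trans (m≡m%n+[m/n]*n t m) (+-comm ρ _)) 2∣t)
                     (∣n⇒∣m*n (t / m) (divides ρ (trans m≡2ρ (*-comm 2 ρ))))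
    ρ≢0 : NonZero ρ
    ρ≢0 = ≢-nonZero (λ ρ≡0 → <⇒≢ m≥1 (sym (trans m≡2ρ (cong (2 *_) ρ≡0))))

  good⇒4∣m : ∀ {t} → GoodT r t → 4 ∣ m
  good⇒4∣m {t} good = subst (4 ∣_) (sym (2^t≈-1⇒m≡2*[t%m] t (proj₂ (proj₂ good))))
                        (*-monoʳ-∣ 2 (proj₁ (good⇒good[t%m] good)))

  4∣m⇒good : Prime r → 4 ∣ m → ∃[ t ] GoodT r t
  4∣m⇒good r-prime (divides u m≡u*4) = h , divides u refl , *-monoˡ-≤ 2 u>0 , 2^h≈-1
    where
    h = u * 2
    u>0 : u > 0
    u>0 = n≢0⇒n>0 (λ { refl → <⇒≢ m≥1 (sym m≡u*4) })
    h>0 : h > 0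
    h>0 = ≤-trans u>0 (m≤m*n u 2)
    m≡h+h : m ≡ h + h
    m≡h+h = trans m≡u*4 (solve 1 (λ u → u :* con 4 := u :* con 2 :+ u :* con 2) refl u)
    h<m : h < m
    h<m = subst (h <_) (sym m≡h+h) (m<m+n h h>0)
    2^h*2^h≈1 : 2 ^ h * 2 ^ h ≈ 1
    2^h*2^h≈1 = begin
      2 ^ h * 2 ^ h    ≡⟨ ^-distribˡ-+-* 2 h h ⟨
      2 ^ (h + h)      ≡⟨ cong (2 ^_) m≡h+h ⟨
      2 ^ m            ≈⟨ 2^m≈1 ⟩
      1                ∎
      where open ≈-Reasoning
    2^h≈-1 : 2 ^ h ≈-1
    2^h≈-1 = [ (λ 2^h≈1 → ⊥-elim (<⇒≱ h<m (m-least h h>0 2^h≈1)))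
             , Equivalence.from ∣⇔≈0 ]′ (x*x≈1⇒x≈1⊎x+1≈0 r-prime (2 ^ h) 2^h*2^h≈1)

  minGood⇒m≡2*t₀ : ∀ {t₀} → MinGoodT r t₀ → m ≡ 2 * t₀
  minGood⇒m≡2*t₀ {t₀} (good , least) =
    trans (2^t≈-1⇒m≡2*[t%m] t₀ (proj₂ (proj₂ good))) (cong (2 *_) t₀%m≡t₀)
    where
    t₀%m≡t₀ : t₀ % m ≡ t₀
    t₀%m≡t₀ = ≤-antisym (m%n≤m t₀ m) (least (t₀ % m) (good⇒good[t%m] good))

  minGood⇒2^t≈-1⇔t≡t₀+k*2t₀ : ∀ {t₀} → MinGoodT r t₀ → ∀ t → 2 ^ t ≈-1 ⇔ (∃[ k ] t ≡ t₀ + k * (2 * t₀))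
  minGood⇒2^t≈-1⇔t≡t₀+k*2t₀ {t₀} min@((_ , _ , 2^t₀≈-1) , _) t =
    subst (λ n → 2 ^ t ≈-1 ⇔ (∃[ k ] t ≡ t₀ + k * n)) m≡2t₀ (2^t≈-1⇔t≡h+k*m m≡2t₀ 2^t₀≈-1 t)
    where
    m≡2t₀ = minGood⇒m≡2*t₀ min

  minGood⇒leastK : ∀ {t₀} → MinGoodT r t₀ → LeastK r (t₀ ∸ 1)
  minGood⇒leastK {suc t'} min@((_ , _ , 2^t₀≈-1) , _) = 2^t₀≈-1 , least
    where
    least : ∀ j → 2 ^ suc j ≈-1 → t' ≤ j
    least j 2^[1+j]≈-1 with k , 1+j≡t₀+k*m ← Equivalence.to (minGood⇒2^t≈-1⇔t≡t₀+k*2t₀ min (suc j)) 2^[1+j]≈-1 =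
      s≤s⁻¹ (subst (suc t' ≤_) (sym 1+j≡t₀+k*m) (m≤m+n (suc t') _))

  minGood⇒2^[1+k]≈-1⇔k≡t₀∸1 : ∀ {t₀} → MinGoodT r t₀ → ∀ k → 2 ^ suc k ≈-1 ⇔ (k ≡ t₀ ∸ 1 [mod 2 * t₀ ])
  minGood⇒2^[1+k]≈-1⇔k≡t₀∸1 {t₀@(suc t')} min k = begin
    2 ^ suc k ≈-1                          ∼⟨ minGood⇒2^t≈-1⇔t≡t₀+k*2t₀ min (suc k) ⟩
    (∃[ e ] suc k ≡ t₀ + e * (2 * t₀))     ∼⟨ mk⇔ (map₂ suc-injective) (map₂ (cong suc)) ⟩
    (∃[ e ] k ≡ t' + e * (2 * t₀))         ∼⟨ ⇔-sym (Modular.≈⇔∃[k]a≡b+k*n (2 * t₀) t'<2t₀) ⟩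
    Modular._≈_ (2 * t₀) k t'              ∼⟨ ⇔-sym (Modular.≡[mod]⇔≈ (2 * t₀)) ⟩
    k ≡ t' [mod 2 * t₀ ]                   ∎
    where
    open EquationalReasoning
    t'<2t₀ : t' < 2 * t₀
    t'<2t₀ = m≤m+n t₀ (t₀ + 0)

-- 14 (d² − 1) ≡ 0 (mod 6) for every divisor d of 14.
S[2+k]14⇔S[k]14 : ∀ k → S (2 + k) 14 ⇔ S k 14
S[2+k]14⇔S[k]14 k = mk⇔ (map₂ (λ h → from ≡[mod]⇔≈ (≈-trans (≈-sym period) (to ≡[mod]⇔≈ h))))
                         (map₂ (λ h → from ≡[mod]⇔≈ (≈-trans period (to ≡[mod]⇔≈ h))))
  where
  open Modular 6
  open Equivalence
  x = 7 * 2 ^ k + 112 * 7 ^ k + 455 * 14 ^ k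
  14σ[2+k]≡14σ[k]+x*6 : 14 * σ (2 + k) 14 ≡ 14 * σ k 14 + x * 6
  14σ[2+k]≡14σ[k]+x*6 = solve 4
    (λ a b c d → con 14 :* (con 1 :* (con 1 :* a) :+ (con 2 :* (con 2 :* b) :+ (con 7 :* (con 7 :* c) :+ (con 14 :* (con 14 :* d) :+ con 0))))
               := con 14 :* (a :+ (b :+ (c :+ (d :+ con 0)))) :+ (con 7 :* b :+ con 112 :* c :+ con 455 :* d) :* con 6)
    refl (1 ^ k) (2 ^ k) (7 ^ k) (14 ^ k)
  period : 14 * σ (2 + k) 14 ≈ 14 * σ k 14
  period = ≈-trans (reflexive 14σ[2+k]≡14σ[k]+x*6) (m+k*n≈m _ x)

S[k]14⇔2∣k : ∀ k → S k 14 ⇔ 2 ∣ k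
S[k]14⇔2∣k 0             = mk⇔ (λ _ → divides 0 refl) (λ _ → composite-≢ 2 (λ ()) (divides 7 refl) , divides 9 refl)
-- 14 σ₁(14) − 2 = 334 ≡ 4 (mod 6)
S[k]14⇔2∣k 1             = mk⇔ (λ (_ , 6∣334) → case n∣m⇒m%n≡0 334 6 6∣334 of λ ())
                                (λ 2∣1 → case ∣1⇒≡1 2∣1 of λ ())
S[k]14⇔2∣k (suc (suc k)) = begin
  S (2 + k) 14  ∼⟨ S[2+k]14⇔S[k]14 k ⟩
  S k 14        ∼⟨ S[k]14⇔2∣k k ⟩
  2 ∣ k         ∼⟨ mk⇔ (∣m∣n⇒∣m+n ∣-refl) (λ 2∣2+k → ∣m+n∣m⇒∣n 2∣2+k ∣-refl) ⟩
  2 ∣ 2 + k     ∎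
  where open EquationalReasoning

module TwiceOddPrime (r : ℕ) .{{_ : NonZero r}} (p-prime : Prime (suc (2 * r))) where

  p : ℕ
  p = suc (2 * r)

  2≤2r : 2 ≤ 2 * r
  2≤2r = *-monoʳ-≤ 2 (>-nonZero⁻¹ r)

  2<p : 2 < p
  2<p = s≤s 2≤2r

  2∣2p : 2 ∣ 2 * p
  2∣2p = divides p (*-comm 2 p)

  p∣i⇒i≡p⊎2∣i : ∀ {i} → p ∣ i → 0 < i → i ≤ 2 * p → i ≡ p ⊎ 2 ∣ i
  p∣i⇒i≡p⊎2∣i p∣i 0<i i≤2p = [ inj₁ , (λ { refl → inj₂ 2∣2p }) ]′ (∣∧≤2*⇒≡⊎≡2* p∣i 0<i i≤2p)

  ¬∣2p : ∀ {i} → 2 < i → i < 2 * p → i ≢ p → ¬ i ∣ 2 * p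
  ¬∣2p 2<i i<2p i≢p i∣2p with ∣2*p⇒≡1⊎≡2⊎≡p⊎≡2*p p-prime i∣2p
  ... | inj₁ refl               = <⇒≱ 2<i (s≤s z≤n)
  ... | inj₂ (inj₁ refl)        = <-irrefl refl 2<i
  ... | inj₂ (inj₂ (inj₁ i≡p))  = i≢p i≡p
  ... | inj₂ (inj₂ (inj₂ refl)) = <-irrefl refl i<2p

  gcd[i,2p]≡1⇔2∤i : ∀ {i} → 0 < i → i ≤ 2 * p → i ≢ p → gcd i (2 * p) ≡ 1 ⇔ (¬ 2 ∣ i)
  gcd[i,2p]≡1⇔2∤i {i} 0<i i≤2p i≢p = mk⇔
    (λ gcd≡1 2∣i → common-divisor⇒gcd≢1 (s≤s (s≤s z≤n)) 2∣i 2∣2p gcd≡1)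
    (λ 2∤i → coprime⇒gcd≡1 (i⊥2p 2∤i))
    where
    i⊥2p : ¬ 2 ∣ i → Coprime i (2 * p)
    i⊥2p 2∤i (c∣i , c∣2p) with ∣2*p⇒≡1⊎≡2⊎≡p⊎≡2*p p-prime c∣2p
    ... | inj₁ c≡1                = c≡1
    ... | inj₂ (inj₁ refl)        = ⊥-elim (2∤i c∣i)
    ... | inj₂ (inj₂ (inj₁ refl)) = ⊥-elim ([ i≢p , 2∤i ]′ (p∣i⇒i≡p⊎2∣i c∣i 0<i i≤2p))
    ... | inj₂ (inj₂ (inj₂ refl)) = ⊥-elim (2∤i (∣-trans 2∣2p c∣i))

  divisors[2p] : divisors (2 * p) ≡ 1 ∷ 2 ∷ p ∷ 2 * p ∷ []
  divisors[2p] = begin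
    filter D? (oneTo (2 * p))                 ≡⟨ filter-oneTo-accept D? 1+p+2r≡2p ∣-refl ⟩
    filter D? (oneTo (p + 2 * r)) ∷ʳ 2 * p    ≡⟨ cong (_∷ʳ 2 * p) (filter-oneTo-gap D? (m≤m+n p _) upper-gap) ⟩
    filter D? (oneTo p) ∷ʳ 2 * p              ≡⟨ cong (_∷ʳ 2 * p) (filter-oneTo-accept D? refl (n∣m*n 2)) ⟩
    filter D? (oneTo (2 * r)) ∷ʳ p ∷ʳ 2 * p   ≡⟨ cong (λ xs → xs ∷ʳ p ∷ʳ 2 * p) (filter-oneTo-gap D? 2≤2r lower-gap) ⟩
    filter D? (oneTo 2) ∷ʳ p ∷ʳ 2 * p         ≡⟨ cong (λ xs → xs ∷ʳ p ∷ʳ 2 * p) (trans (filter-accept D? (1∣ _)) (cong (1 ∷_) (filter-accept D? 2∣2p))) ⟩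
    1 ∷ 2 ∷ p ∷ 2 * p ∷ []                    ∎
    where
    open ≡-Reasoning
    D? = _∣? (2 * p)
    1+p+2r≡2p : suc (p + 2 * r) ≡ 2 * p
    1+p+2r≡2p = solve 1 (λ r → con 1 :+ (con 1 :+ con 2 :* r) :+ con 2 :* r := con 2 :* (con 1 :+ con 2 :* r)) refl r
    lower-gap : ∀ i → 2 < i → i ≤ 2 * r → ¬ i ∣ 2 * p
    lower-gap i 2<i i≤2r = ¬∣2p 2<i (≤-trans (s≤s i≤2r) (m≤m+n p _)) (<⇒≢ (s≤s i≤2r))
    upper-gap : ∀ i → p < i → i ≤ p + 2 * r → ¬ i ∣ 2 * p
    upper-gap i p<i i≤p+2r = ¬∣2p (<-trans 2<p p<i) (subst (i <_) 1+p+2r≡2p (s≤s i≤p+2r)) (>⇒≢ p<i)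

  φ[2p]≡2r : φ (2 * p) ≡ 2 * r
  φ[2p]≡2r = begin
    countUpTo C? (2 * p)             ≡⟨ cong (countUpTo C?) 2p≡2[1+r+r] ⟩
    countUpTo C? (2 * (suc r + r))   ≡⟨ countUpTo-odd C? (suc r) r upper-odd ⟩
    countUpTo C? (2 * suc r) + r     ≡⟨ cong (_+ r) skip-p ⟩
    countUpTo C? (2 * (0 + r)) + r   ≡⟨ cong (_+ r) (countUpTo-odd C? 0 r lower-odd) ⟩
    r + r                            ≡⟨ cong (r +_) (+-identityʳ r) ⟨
    2 * r                            ∎
    where
    open ≡-Reasoning
    C? = λ i → gcd i (2 * p) ≟ 1
    2p≡2[1+r+r] : 2 * p ≡ 2 * (suc r + r)
    2p≡2[1+r+r] = solve 1 (λ r → con 2 :* (con 1 :+ con 2 :* r) := con 2 :* (con 1 :+ r :+ r)) refl r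
    skip-p : countUpTo C? (2 * suc r) ≡ countUpTo C? (2 * r)
    skip-p = cong length (trans
      (filter-oneTo-reject C? (sym (*-suc 2 r)) (common-divisor⇒gcd≢1 (s≤s (s≤s z≤n)) (m∣m*n (suc r)) 2∣2p))
      (filter-oneTo-reject C? refl (common-divisor⇒gcd≢1 (<-trans (s≤s (s≤s z≤n)) 2<p) ∣-refl (n∣m*n 2))))
    lower-odd : ∀ i → 0 < i → i ≤ 2 * r → gcd i (2 * p) ≡ 1 ⇔ (¬ 2 ∣ i)
    lower-odd i 0<i i≤2r = gcd[i,2p]≡1⇔2∤i 0<i (≤-trans i≤2r (≤-trans (n≤1+n _) (m≤m+n p _))) (<⇒≢ (s≤s i≤2r))
    upper-odd : ∀ i → 2 * suc r < i → i ≤ 2 * (suc r + r) → gcd i (2 * p) ≡ 1 ⇔ (¬ 2 ∣ i)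
    upper-odd i 2r+2<i i≤ = gcd[i,2p]≡1⇔2∤i (≤-trans (s≤s z≤n) 2r+2<i) (subst (i ≤_) (sym 2p≡2[1+r+r]) i≤)
                           (>⇒≢ (≤-trans (≤-reflexive (sym (*-suc 2 r))) (<⇒≤ 2r+2<i)))

  open Modular r

  p*σ[k][2p]≈2^[1+k]+2 : ∀ k → p * σ k (2 * p) ≈ 2 ^ suc k + 1 + 1
  p*σ[k][2p]≈2^[1+k]+2 k = begin
    p * σ k (2 * p)                                     ≡⟨ cong (λ ds → p * sum (map (_^ k) ds)) divisors[2p] ⟩
    p * (1 ^ k + (2 ^ k + (p ^ k + ((2 * p) ^ k + 0)))) ≈⟨ *-cong p≈1 (+-cong (≈-refl {1 ^ k}) (+-cong (≈-refl {2 ^ k})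
                                                             (+-cong (^-congˡ k p≈1) (+-cong (^-congˡ k (*-cong (≈-refl {2}) p≈1)) (≈-refl {0}))))) ⟩
    1 * (1 ^ k + (2 ^ k + (1 ^ k + ((2 * 1) ^ k + 0)))) ≡⟨ cong (λ x → 1 * (x + (2 ^ k + (x + (2 ^ k + 0))))) (^-zeroˡ k) ⟩
    1 * (1 + (2 ^ k + (1 + (2 ^ k + 0))))               ≡⟨ solve 1 (λ x → con 1 :* (con 1 :+ (x :+ (con 1 :+ (x :+ con 0)))) := con 2 :* x :+ con 1 :+ con 1) refl (2 ^ k) ⟩
    2 ^ suc k + 1 + 1                                   ∎
    where
    open ≈-Reasoning
    p≈1 : p ≈ 1
    p≈1 = m+k*n≈m 1 2

  S[k][2p]⇔r∣2^[1+k]+1 : ∀ k → S k (2 * p) ⇔ r ∣ 2 ^ suc k + 1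
  S[k][2p]⇔r∣2^[1+k]+1 k = begin
    S k (2 * p)                                 ∼⟨ mk⇔ proj₂ (composite-≢ 2 (<⇒≢ 2<2p) 2∣2p ,_) ⟩
    2 * p * σ k (2 * p) ≡ 2 [mod φ (2 * p) ]    ≡⟨ cong₂ (λ x n → x ≡ 2 [mod n ]) (*-assoc 2 p (σ k (2 * p))) φ[2p]≡2r ⟩
    2 * (p * σ k (2 * p)) ≡ 2 * 1 [mod 2 * r ]  ∼⟨ *-cancelˡ-≡[mod] 2 {p * σ k (2 * p)} {1} {r} ⟩
    p * σ k (2 * p) ≡ 1 [mod r ]                ∼⟨ ≡[mod]⇔≈ ⟩
    p * σ k (2 * p) ≈ 1                         ∼⟨ mk⇔ (≈-trans (≈-sym pσ≈)) (≈-trans pσ≈) ⟩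
    2 ^ suc k + 1 + 1 ≈ 0 + 1                   ∼⟨ mk⇔ (+-cancelʳ-≈ 1) (λ e → +-cong e (≈-refl {1})) ⟩
    2 ^ suc k + 1 ≈ 0                           ∼⟨ ⇔-sym ∣⇔≈0 ⟩
    r ∣ 2 ^ suc k + 1                           ∎
    where
    open EquationalReasoning
    pσ≈ = p*σ[k][2p]≈2^[1+k]+2 k
    2<2p : 2 < 2 * p
    2<2p = *-monoʳ-< 2 (<-trans (s≤s (s≤s z≤n)) 2<p)

  flanks⇔good : FlanksAtSomeK p ⇔ (∃[ t ] GoodT r t)
  flanks⇔good = mk⇔ to from
    where
    open Equivalence using () renaming (to to ⇒; from to ⇐)
    to : FlanksAtSomeK p → ∃[ t ] GoodT r t
    to (k , k≥1 , S[k][2p] , _ , S[1+k]14) =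
      suc k , ⇒ (S[k]14⇔2∣k (suc k)) S[1+k]14 , s≤s k≥1 , ⇒ (S[k][2p]⇔r∣2^[1+k]+1 k) S[k][2p]
    from : ∃[ t ] GoodT r t → FlanksAtSomeK p
    from (1 , _ , s≤s () , _)
    from (suc (suc k) , 2∣2+k , _ , r∣2^t+1) =
      suc k , s≤s z≤n , ⇐ (S[k][2p]⇔r∣2^[1+k]+1 (suc k)) r∣2^t+1 ,
      ⇐ (S[k]14⇔2∣k k) (∣m+n∣m⇒∣n 2∣2+k ∣-refl) , ⇐ (S[k]14⇔2∣k (2 + k)) 2∣2+k

-- p % 4 ≡ 3 only serves to exclude p = 5, for which r = 2 divides 2.
p≡1+2r∧r≥3 : ∀ {p r} → 5 ≤ p → p % 4 ≡ 3 → p ∸ 1 ≡ 2 * r → p ≡ suc (2 * r) × 3 ≤ r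
p≡1+2r∧r≥3 {p} {r} 5≤p p%4≡3 p∸1≡2r = p≡1+2r , r≥3 r p≡1+2r 5≤p p%4≡3
  where
  p≡1+2r : p ≡ suc (2 * r)
  p≡1+2r = trans (sym (m+[n∸m]≡n (≤-trans (s≤s z≤n) 5≤p))) (cong suc p∸1≡2r)
  r≥3 : ∀ r → p ≡ suc (2 * r) → 5 ≤ p → p % 4 ≡ 3 → 3 ≤ r
  r≥3 0                   refl (s≤s ())                 _
  r≥3 1                   refl (s≤s (s≤s (s≤s ())))     _
  r≥3 2                   refl _                        ()
  r≥3 (suc (suc (suc _))) _    _                        _ = s≤s (s≤s (s≤s z≤n))

theorem4p1 : ∀ (p : ℕ) → Prime p → 5 ≤ p → p % 4 ≡ 3 →
  ∀ (r : ℕ) → p ∸ 1 ≡ 2 * r →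
  ∀ (m : ℕ) → IsOrd2 r m →
    (FlanksAtSomeK p ⇔ (∃[ t0 ] GoodT r t0))
    × (∀ t0 → MinGoodT r t0 →
         m ≡ 2 * t0
         × LeastK r (t0 ∸ 1)
         × (∀ k → (r ∣ (2 ^ suc k + 1) ⇔ (k ≡ t0 ∸ 1 [mod 2 * t0 ]))))
    × (Prime r → ((∃[ t0 ] GoodT r t0) ⇔ (4 ∣ m)))
theorem4p1 p p-prime 5≤p p%4≡3 r p∸1≡2r m ord
  with refl , r≥3 ← p≡1+2r∧r≥3 {p} {r} 5≤p p%4≡3 p∸1≡2r =
    flanks⇔good ,
    (λ t₀ min → minGood⇒m≡2*t₀ min , minGood⇒leastK min , minGood⇒2^[1+k]≈-1⇔k≡t₀∸1 min) ,
    (λ r-prime → mk⇔ (λ (_ , good) → good⇒4∣m good) (4∣m⇒good r-prime))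
  where
  instance
    r≢0 : NonZero r
    r≢0 = >-nonZero (≤-trans (s≤s z≤n) r≥3)
  r∤2 : ¬ r ∣ 2
  r∤2 r∣2 = <⇒≱ r≥3 (∣⇒≤ r∣2)
  open TwiceOddPrime r p-prime
  open PowersOfTwo r r∤2 ord
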